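{- Let $v\ge 2$. If there exists a uniform covering array $\mathrm{UCA}(N;v+2,v)$, then $N\ge v^2+v-1$. Further, if $N=v^2+v-1$, then every pair of distinct rows agree in either one or two columns, and for each pair of distinct columns $c,c'$ there are exactly $v-1$ pairs of symbols $(x,y)$ that occur twice in columns $(c,c')$ (i.e., exactly two rows have $x$ in column $c$ and $y$ in column $c'$), and these $v-1$ pairs are disjoint (no two of them share the same symbol in column $c$ or the same symbol in column $c'$).
   Context: A (strength-$2$) covering array $\mathrm{CA}(N;k,v)$ is an $N\times k$ array with entries from $\{0,1,\dots,v-1\}$ such that for every choice of two distinct columns $c,c'$ and every pair $(x,y)$ of symbols, there is at least one row with entry $x$ in column $c$ and entry $y$ in column $c'$. It is uniform, written $\mathrm{UCA}(N;k,v)$, if in every column every symbol occurs either $\lfloor N/v\rfloor$ or $\lceil N/v\rceil$ times. Two rows agree in a column if they have the same entry in that column. -}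

module Defs where

open import Data.Nat using (ℕ; zero; suc; _+_; _*_; _∸_; _≤_; NonZero)
open import Data.Nat.DivMod using (_/_)
open import Data.Fin using (Fin; zero; suc)
open import Data.Product using (Σ; ∃; _×_; _,_)
open import Relation.Nullary using (Dec; yes; no; ¬_)
open import Relation.Unary using (Pred; Decidable)
open import Relation.Binary.PropositionalEquality using (_≡_; _≢_)
open import Data.Fin using (_≟_)
open import Level using (0ℓ)

count : ∀ {n} {P : Pred (Fin n) 0ℓ} → Decidable P → ℕ
count {zero} _ = 0
count {suc n} P? with P? zero
... | yes _ = suc (count (λ i → P? (suc i)))
... | no _ = count (λ i → P? (suc i))

Array : ℕ → ℕ → ℕ → Set
Array N k v = Fin N → Fin k → Fin v

IsCA : ∀ {N k v} → Array N k v → Set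
IsCA {N} {k} {v} A =
  (c c' : Fin k) → c ≢ c' → (x y : Fin v) →
  ∃ λ (r : Fin N) → (A r c ≡ x) × (A r c' ≡ y)

symCount : ∀ {N k v} → Array N k v → Fin k → Fin v → ℕ
symCount A c x = count (λ r → A r c ≟ x)

-- uniform: every symbol occurs ⌊N/v⌋ or ⌈N/v⌉ times in every column
-- (⌈N/v⌉ = (N + v - 1) / v)
IsUniform : ∀ {N k v} .{{_ : NonZero v}} → Array N k v → Set
IsUniform {N} {k} {v} A =
  (c : Fin k) → (x : Fin v) →
  (symCount A c x ≡ N / v) Data.Sum.⊎ (symCount A c x ≡ (N + (v ∸ 1)) / v)
  where import Data.Sum

IsUCA : ∀ {N k v} .{{_ : NonZero v}} → Array N k v → Set
IsUCA A = IsCA A × IsUniform A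

agreements : ∀ {N k v} → Array N k v → Fin N → Fin N → ℕ
agreements A r r' = count (λ c → A r c ≟ A r' c)

pairCount : ∀ {N k v} → Array N k v → Fin k → Fin k → Fin v → Fin v → ℕ
pairCount A c c' x y = count (λ r → (A r c ≟ x) Relation.Nullary.×-dec (A r c' ≟ y))
  where import Relation.Nullary

sumFin : ∀ {n} → (Fin n → ℕ) → ℕ
sumFin {zero} _ = 0
sumFin {suc n} f = f zero + sumFin (λ i → f (suc i))

twicePairsCount : ∀ {N k v} → Array N k v → Fin k → Fin k → ℕ
twicePairsCount A c c' =
  sumFin (λ x → count (λ y → pairCount A c c' x y Data.Nat.≟ 2))
  where import Data.Nat

TwicePairsDisjoint : ∀ {N k v} → Array N k v → Fin k → Fin k → Set
TwicePairsDisjoint {v = v} A c c' =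
  (x y x' y' : Fin v) → pairCount A c c' x y ≡ 2 → pairCount A c c' x' y' ≡ 2 →
  ¬ ((x ≡ x') × (y ≡ y')) → (x ≢ x') × (y ≢ y')

{-# OPTIONS --safe #-}
-- Let λ(r, r') be the number of columns in which rows r and r' agree, n(c, x) the number of
-- occurrences of x in column c and p(c, c', x, y) that of (x, y) in columns (c, c').  Double
-- counting gives Σ λ = Σ_c Σ_x n² and Σ λ² = Σ_{c,c'} Σ_{x,y} p², summed over ordered pairs of
-- rows.  If N ≤ v² + v, uniformity gives n ≤ v + 1, covering gives p ≥ 1 and hence n ≥ v, and
-- then p ∈ {1, 2} whenever c ≠ c'.  Both moments are then fixed by N and v, and for k = v + 2
-- columns they yield Σ_{r ≠ r'} (λ − 1)(λ − 2) = 2N(N + 1 − v² − v).  The left side is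
-- non-negative, so N ≥ v² + v − 1; at equality every term vanishes, i.e. λ ∈ {1, 2}.  Finally
-- Σ_y (p(c, c', x, y) − 1) = n(c, x) − v ≤ 1 counts the pairs (x, y) occurring twice: there are
-- N − v² = v − 1 of them, and no two share a symbol.
module Submission where

open import Defs
open import Data.Bool using (if_then_else_)
open import Data.Fin using (Fin; zero; suc; _≟_; punchIn; punchOut)
open import Data.Fin.Properties using (punchIn-punchOut; punchInᵢ≢i; nonZeroIndex)
open import Data.Nat as ℕ using (ℕ; zero; suc; _+_; _*_; _∸_; _≤_; _<_; z≤n; s≤s; NonZero; pred; _≤?_)
open import Data.Nat.DivMod using (_/_; m<n*o⇒m/o<n; /-monoˡ-≤)
open import Data.Nat.Properties hiding (_≟_)
open import Algebra.Properties.Semiring.Sum +-*-semiring using (sum; sum-syntax; sum-cong-≗; sum-remove; ∑-comm; ∑-distrib-+; *-distribˡ-sum; *-distribʳ-sum)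
open import Data.Nat.Tactic.RingSolver using (solve-∀)
open import Data.Product using (∃; _×_; _,_; proj₁; proj₂)
open import Data.Sum using (_⊎_; inj₁; inj₂)
open import Data.Vec.Functional using (removeAt)
open import Function using (_∘_)
open import Level using (0ℓ)
open import Relation.Binary.PropositionalEquality
open import Relation.Nullary using (Dec; does; yes; no; _×-dec_; contradiction)
open import Relation.Unary using (Pred; Decidable)

𝟙 : ∀ {p} {P : Set p} → Dec P → ℕ
𝟙 d = if does d then 1 else 0

𝟙-yes : ∀ {p} {P : Set p} (d : Dec P) → P → 𝟙 d ≡ 1
𝟙-yes (yes _) _ = refl
𝟙-yes (no ¬p) p = contradiction p ¬p

𝟙-idem : ∀ {p} {P : Set p} (d : Dec P) → 𝟙 d * 𝟙 d ≡ 𝟙 d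
𝟙-idem (yes _) = refl
𝟙-idem (no _) = refl

𝟙-×-dec : ∀ {p q} {P : Set p} {Q : Set q} (d : Dec P) (e : Dec Q) → 𝟙 (d ×-dec e) ≡ 𝟙 d * 𝟙 e
𝟙-×-dec (yes _) (yes _) = refl
𝟙-×-dec (yes _) (no _) = refl
𝟙-×-dec (no _) _ = refl

𝟙-≟-sym : ∀ {n} (a b : Fin n) → 𝟙 (a ≟ b) ≡ 𝟙 (b ≟ a)
𝟙-≟-sym a b with a ≟ b | b ≟ a
... | yes _   | yes _   = refl
... | no _    | no _    = refl
... | yes a≡b | no b≢a  = contradiction (sym a≡b) b≢a
... | no a≢b  | yes b≡a = contradiction (sym b≡a) a≢b

count≡∑𝟙 : ∀ {n} {P : Pred (Fin n) 0ℓ} (P? : Decidable P) → count P? ≡ ∑[ i < n ] 𝟙 (P? i)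
count≡∑𝟙 {zero} P? = refl
count≡∑𝟙 {suc n} P? with P? zero
... | yes _ = cong suc (count≡∑𝟙 (P? ∘ suc))
... | no _  = count≡∑𝟙 (P? ∘ suc)

sumFin≡sum : ∀ {n} (f : Fin n → ℕ) → sumFin f ≡ sum f
sumFin≡sum {zero} f = refl
sumFin≡sum {suc n} f = cong (f zero +_) (sumFin≡sum (f ∘ suc))

∑-const : ∀ n a → ∑[ i < n ] a ≡ n * a
∑-const zero a = refl
∑-const (suc n) a = cong (a +_) (∑-const n a)

∑-+-const : ∀ {n} (f : Fin n → ℕ) a → ∑[ i < n ] (f i + a) ≡ sum f + n * a
∑-+-const {n} f a = trans (∑-distrib-+ f (λ _ → a)) (cong (sum f +_) (∑-const n a))

∑-+-cong : ∀ {n} {f g : Fin n → ℕ} {a b} → (∀ i → f i + a ≡ g i + b) → sum f + n * a ≡ sum g + n * b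
∑-+-cong {f = f} {g} {a} {b} f+a≡g+b =
  trans (sym (∑-+-const f a)) (trans (sum-cong-≗ f+a≡g+b) (∑-+-const g b))

∑-+-cong-const : ∀ {n} {f : Fin n → ℕ} {a b} → (∀ i → f i + a ≡ b) → sum f + n * a ≡ n * b
∑-+-cong-const {n} {f} {a} {b} f+a≡b =
  trans (sym (∑-+-const f a)) (trans (sum-cong-≗ f+a≡b) (∑-const n b))

∑-+-*-cong : ∀ {n} {f g h : Fin n → ℕ} {a b} → (∀ i → f i + a * g i ≡ h i + b) →
             sum f + a * sum g ≡ sum h + n * b
∑-+-*-cong {n} {f} {g} {h} {a} {b} eq = begin
  sum f + a * sum g              ≡⟨ cong (sum f +_) (*-distribˡ-sum a g) ⟩
  sum f + ∑[ i < n ] (a * g i)  ≡⟨ ∑-distrib-+ f (λ i → a * g i) ⟨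
  ∑[ i < n ] (f i + a * g i)    ≡⟨ sum-cong-≗ eq ⟩
  ∑[ i < n ] (h i + b)          ≡⟨ ∑-+-const h b ⟩
  sum h + n * b                  ∎
  where open ≡-Reasoning

∑-mono-≤ : ∀ {n} {f g : Fin n → ℕ} → (∀ i → f i ≤ g i) → sum f ≤ sum g
∑-mono-≤ {zero} _ = z≤n
∑-mono-≤ {suc n} f≤g = +-mono-≤ (f≤g zero) (∑-mono-≤ (f≤g ∘ suc))

term≤∑ : ∀ {n} (f : Fin n → ℕ) i → f i ≤ sum f
term≤∑ {suc n} f i = ≤-trans (m≤m+n (f i) _) (≤-reflexive (sym (sum-remove {i = i} f)))

two-terms≤∑ : ∀ {n} (f : Fin n → ℕ) {i j} → i ≢ j → f i + f j ≤ sum f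
two-terms≤∑ {suc n} f {i} {j} i≢j = begin
  f i + f j                           ≡⟨ cong (λ t → f i + f t) (punchIn-punchOut i≢j) ⟨
  f i + removeAt f i (punchOut i≢j)  ≤⟨ +-monoʳ-≤ (f i) (term≤∑ (removeAt f i) _) ⟩
  f i + sum (removeAt f i)            ≡⟨ sum-remove f ⟨
  sum f                               ∎
  where open ≤-Reasoning

∑-mono-≤-gap : ∀ {n} {f g : Fin n → ℕ} {d} (j : Fin n) → (∀ i → f i ≤ g i) → f j + d ≤ g j →
               sum f + d ≤ sum g
∑-mono-≤-gap {suc n} {f} {g} {d} j f≤g fⱼ+d≤gⱼ = begin
  sum f + d                            ≡⟨ cong (_+ d) (sum-remove f) ⟩
  f j + sum (removeAt f j) + d         ≡⟨ +-assoc (f j) _ d ⟩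
  f j + (sum (removeAt f j) + d)       ≡⟨ cong (f j +_) (+-comm _ d) ⟩
  f j + (d + sum (removeAt f j))       ≡⟨ +-assoc (f j) d _ ⟨
  f j + d + sum (removeAt f j)         ≤⟨ +-mono-≤ fⱼ+d≤gⱼ (∑-mono-≤ (f≤g ∘ punchIn j)) ⟩
  g j + sum (removeAt g j)             ≡⟨ sum-remove g ⟨
  sum g                                ∎
  where open ≤-Reasoning

∑-except : ∀ {n} (f : Fin n → ℕ) {a b} (i : Fin n) → (∀ j → j ≢ i → f j + a ≡ b) →
           sum f + pred n * a ≡ f i + pred n * b
∑-except {suc n} f {a} {b} i f+a≡b = begin
  sum f + n * a                        ≡⟨ cong (_+ n * a) (sum-remove f) ⟩
  f i + sum (removeAt f i) + n * a     ≡⟨ +-assoc (f i) _ _ ⟩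
  f i + (sum (removeAt f i) + n * a)   ≡⟨ cong (f i +_) (∑-+-cong-const (λ j → f+a≡b _ (punchInᵢ≢i i j))) ⟩
  f i + n * b                          ∎
  where open ≡-Reasoning

∑-𝟙≟-* : ∀ {n} (a : Fin n) (g : Fin n → ℕ) → ∑[ x < n ] (𝟙 (a ≟ x) * g x) ≡ g a
∑-𝟙≟-* {suc n} zero g =
  trans (cong₂ _+_ (*-identityˡ (g zero)) (trans (∑-const n 0) (*-zeroʳ n))) (+-identityʳ (g zero))
∑-𝟙≟-* {suc n} (suc a) g = ∑-𝟙≟-* a (g ∘ suc)

∑∑-𝟙≟-* : ∀ {m n} (a : Fin m) (b : Fin n) (g : Fin m → Fin n → ℕ) →
          ∑[ x < m ] ∑[ y < n ] (𝟙 (a ≟ x) * 𝟙 (b ≟ y) * g x y) ≡ g a b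
∑∑-𝟙≟-* {m} {n} a b g = begin
  ∑[ x < m ] ∑[ y < n ] (𝟙 (a ≟ x) * 𝟙 (b ≟ y) * g x y)    ≡⟨ sum-cong-≗ (λ x → sum-cong-≗ (λ y → *-assoc (𝟙 (a ≟ x)) (𝟙 (b ≟ y)) (g x y))) ⟩
  ∑[ x < m ] ∑[ y < n ] (𝟙 (a ≟ x) * (𝟙 (b ≟ y) * g x y))  ≡⟨ sum-cong-≗ (λ x → *-distribˡ-sum (𝟙 (a ≟ x)) (λ y → 𝟙 (b ≟ y) * g x y)) ⟨
  ∑[ x < m ] (𝟙 (a ≟ x) * ∑[ y < n ] (𝟙 (b ≟ y) * g x y))  ≡⟨ sum-cong-≗ (λ x → cong (𝟙 (a ≟ x) *_) (∑-𝟙≟-* b (g x))) ⟩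
  ∑[ x < m ] (𝟙 (a ≟ x) * g x b)                            ≡⟨ ∑-𝟙≟-* a (λ x → g x b) ⟩
  g a b                                                      ∎
  where open ≡-Reasoning

module _ {N k v} (A : Array N k v) where

  agreesAt : Fin k → Fin N → Fin N → ℕ
  agreesAt c r r' = 𝟙 (A r c ≟ A r' c)

  symCountSquares : Fin k → ℕ
  symCountSquares c = ∑[ x < v ] (symCount A c x * symCount A c x)

  pairCountSquares : Fin k → Fin k → ℕ
  pairCountSquares c c' = ∑[ x < v ] ∑[ y < v ] (pairCount A c c' x y * pairCount A c c' x y)

  pairCount≡∑ : ∀ c c' x y → pairCount A c c' x y ≡ ∑[ r < N ] (𝟙 (A r c ≟ x) * 𝟙 (A r c' ≟ y))
  pairCount≡∑ c c' x y = trans (count≡∑𝟙 (λ r → (A r c ≟ x) ×-dec (A r c' ≟ y)))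
                               (sum-cong-≗ (λ r → 𝟙-×-dec (A r c ≟ x) (A r c' ≟ y)))

  pairCount-swap : ∀ c c' x y → pairCount A c c' x y ≡ pairCount A c' c y x
  pairCount-swap c c' x y = begin
    pairCount A c c' x y                                   ≡⟨ pairCount≡∑ c c' x y ⟩
    ∑[ r < N ] (𝟙 (A r c ≟ x) * 𝟙 (A r c' ≟ y))           ≡⟨ sum-cong-≗ (λ r → *-comm (𝟙 (A r c ≟ x)) (𝟙 (A r c' ≟ y))) ⟩
    ∑[ r < N ] (𝟙 (A r c' ≟ y) * 𝟙 (A r c ≟ x))           ≡⟨ pairCount≡∑ c' c y x ⟨
    pairCount A c' c y x                                   ∎
    where open ≡-Reasoning

  ∑-pairCount : ∀ c c' x → ∑[ y < v ] pairCount A c c' x y ≡ symCount A c x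
  ∑-pairCount c c' x = begin
    ∑[ y < v ] pairCount A c c' x y                                ≡⟨ sum-cong-≗ (pairCount≡∑ c c' x) ⟩
    ∑[ y < v ] ∑[ r < N ] (𝟙 (A r c ≟ x) * 𝟙 (A r c' ≟ y))       ≡⟨ ∑-comm (λ y r → 𝟙 (A r c ≟ x) * 𝟙 (A r c' ≟ y)) ⟩
    ∑[ r < N ] ∑[ y < v ] (𝟙 (A r c ≟ x) * 𝟙 (A r c' ≟ y))       ≡⟨ sum-cong-≗ (λ r → *-distribˡ-sum (𝟙 (A r c ≟ x)) (λ y → 𝟙 (A r c' ≟ y))) ⟨
    ∑[ r < N ] (𝟙 (A r c ≟ x) * ∑[ y < v ] 𝟙 (A r c' ≟ y))       ≡⟨ sum-cong-≗ (λ r → cong (𝟙 (A r c ≟ x) *_) (∑-𝟙≟ (A r c'))) ⟩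
    ∑[ r < N ] (𝟙 (A r c ≟ x) * 1)                                ≡⟨ sum-cong-≗ (λ r → *-identityʳ (𝟙 (A r c ≟ x))) ⟩
    ∑[ r < N ] 𝟙 (A r c ≟ x)                                      ≡⟨ count≡∑𝟙 (λ r → A r c ≟ x) ⟨
    symCount A c x                                                 ∎
    where
    open ≡-Reasoning
    ∑-𝟙≟ : (a : Fin v) → ∑[ y < v ] 𝟙 (a ≟ y) ≡ 1
    ∑-𝟙≟ a = trans (sum-cong-≗ (λ y → sym (*-identityʳ (𝟙 (a ≟ y))))) (∑-𝟙≟-* a (λ _ → 1))

  ∑-rows-pairCount : ∀ c c' (g : Fin v → Fin v → ℕ) →
                     ∑[ r < N ] g (A r c) (A r c') ≡ ∑[ x < v ] ∑[ y < v ] (pairCount A c c' x y * g x y)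
  ∑-rows-pairCount c c' g = begin
    ∑[ r < N ] g (A r c) (A r c')                    ≡⟨ sum-cong-≗ (λ r → ∑∑-𝟙≟-* (A r c) (A r c') g) ⟨
    ∑[ r < N ] ∑[ x < v ] ∑[ y < v ] F r x y         ≡⟨ ∑-comm (λ r x → ∑[ y < v ] F r x y) ⟩
    ∑[ x < v ] ∑[ r < N ] ∑[ y < v ] F r x y         ≡⟨ sum-cong-≗ (λ x → ∑-comm (λ r y → F r x y)) ⟩
    ∑[ x < v ] ∑[ y < v ] ∑[ r < N ] F r x y         ≡⟨ sum-cong-≗ (λ x → sum-cong-≗ (λ y → *-distribʳ-sum (g x y) (λ r → 𝟙 (A r c ≟ x) * 𝟙 (A r c' ≟ y)))) ⟨
    ∑[ x < v ] ∑[ y < v ] (∑[ r < N ] (𝟙 (A r c ≟ x) * 𝟙 (A r c' ≟ y)) * g x y)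
                                                      ≡⟨ sum-cong-≗ (λ x → sum-cong-≗ (λ y → cong (_* g x y) (pairCount≡∑ c c' x y))) ⟨
    ∑[ x < v ] ∑[ y < v ] (pairCount A c c' x y * g x y)  ∎
    where
    open ≡-Reasoning
    F : Fin N → Fin v → Fin v → ℕ
    F r x y = 𝟙 (A r c ≟ x) * 𝟙 (A r c' ≟ y) * g x y

  ∑-rows-symCount : ∀ c (g : Fin v → ℕ) → ∑[ r < N ] g (A r c) ≡ ∑[ x < v ] (symCount A c x * g x)
  ∑-rows-symCount c g = begin
    ∑[ r < N ] g (A r c)                                   ≡⟨ ∑-rows-pairCount c c (λ x _ → g x) ⟩
    ∑[ x < v ] ∑[ y < v ] (pairCount A c c x y * g x)     ≡⟨ sum-cong-≗ (λ x → *-distribʳ-sum (g x) (pairCount A c c x)) ⟨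
    ∑[ x < v ] (∑[ y < v ] pairCount A c c x y * g x)     ≡⟨ sum-cong-≗ (λ x → cong (_* g x) (∑-pairCount c c x)) ⟩
    ∑[ x < v ] (symCount A c x * g x)                      ∎
    where open ≡-Reasoning

  ∑-symCount : ∀ c → ∑[ x < v ] symCount A c x ≡ N
  ∑-symCount c = begin
    ∑[ x < v ] symCount A c x          ≡⟨ sum-cong-≗ (λ x → *-identityʳ (symCount A c x)) ⟨
    ∑[ x < v ] (symCount A c x * 1)    ≡⟨ ∑-rows-symCount c (λ _ → 1) ⟨
    ∑[ r < N ] 1                       ≡⟨ ∑-const N 1 ⟩
    N * 1                              ≡⟨ *-identityʳ N ⟩
    N                                  ∎
    where open ≡-Reasoning

  ∑∑-agreesAt : ∀ c → ∑[ r < N ] ∑[ r' < N ] agreesAt c r r' ≡ symCountSquares c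
  ∑∑-agreesAt c = begin
    ∑[ r < N ] ∑[ r' < N ] 𝟙 (A r c ≟ A r' c)   ≡⟨ sum-cong-≗ (λ r → sum-cong-≗ (λ r' → 𝟙-≟-sym (A r c) (A r' c))) ⟩
    ∑[ r < N ] ∑[ r' < N ] 𝟙 (A r' c ≟ A r c)   ≡⟨ sum-cong-≗ (λ r → count≡∑𝟙 (λ r' → A r' c ≟ A r c)) ⟨
    ∑[ r < N ] symCount A c (A r c)              ≡⟨ ∑-rows-symCount c (symCount A c) ⟩
    symCountSquares c                            ∎
    where open ≡-Reasoning

  ∑∑-agreesAt-pair : ∀ c c' → ∑[ r < N ] ∑[ r' < N ] (agreesAt c r r' * agreesAt c' r r') ≡ pairCountSquares c c'
  ∑∑-agreesAt-pair c c' = begin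
    ∑[ r < N ] ∑[ r' < N ] (𝟙 (A r c ≟ A r' c) * 𝟙 (A r c' ≟ A r' c'))
      ≡⟨ sum-cong-≗ (λ r → sum-cong-≗ (λ r' → cong₂ _*_ (𝟙-≟-sym (A r c) (A r' c)) (𝟙-≟-sym (A r c') (A r' c')))) ⟩
    ∑[ r < N ] ∑[ r' < N ] (𝟙 (A r' c ≟ A r c) * 𝟙 (A r' c' ≟ A r c'))
      ≡⟨ sum-cong-≗ (λ r → pairCount≡∑ c c' (A r c) (A r c')) ⟨
    ∑[ r < N ] pairCount A c c' (A r c) (A r c')
      ≡⟨ ∑-rows-pairCount c c' (pairCount A c c') ⟩
    pairCountSquares c c'
      ∎
    where open ≡-Reasoning

  pairCountSquares-diag : ∀ c → pairCountSquares c c ≡ symCountSquares c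
  pairCountSquares-diag c = begin
    pairCountSquares c c                                    ≡⟨ ∑∑-agreesAt-pair c c ⟨
    ∑[ r < N ] ∑[ r' < N ] (agreesAt c r r' * agreesAt c r r')  ≡⟨ sum-cong-≗ (λ r → sum-cong-≗ (λ r' → 𝟙-idem (A r c ≟ A r' c))) ⟩
    ∑[ r < N ] ∑[ r' < N ] agreesAt c r r'                 ≡⟨ ∑∑-agreesAt c ⟩
    symCountSquares c                                       ∎
    where open ≡-Reasoning

  agreements≡∑ : ∀ r r' → agreements A r r' ≡ ∑[ c < k ] agreesAt c r r'
  agreements≡∑ r r' = count≡∑𝟙 (λ c → A r c ≟ A r' c)

  agreements-diag : ∀ r → agreements A r r ≡ k
  agreements-diag r = begin
    agreements A r r            ≡⟨ agreements≡∑ r r ⟩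
    ∑[ c < k ] agreesAt c r r   ≡⟨ sum-cong-≗ (λ c → 𝟙-yes (A r c ≟ A r c) refl) ⟩
    ∑[ c < k ] 1                ≡⟨ ∑-const k 1 ⟩
    k * 1                       ≡⟨ *-identityʳ k ⟩
    k                           ∎
    where open ≡-Reasoning

  ∑∑-agreements : ∑[ r < N ] ∑[ r' < N ] agreements A r r' ≡ ∑[ c < k ] symCountSquares c
  ∑∑-agreements = begin
    ∑[ r < N ] ∑[ r' < N ] agreements A r r'           ≡⟨ sum-cong-≗ (λ r → sum-cong-≗ (agreements≡∑ r)) ⟩
    ∑[ r < N ] ∑[ r' < N ] ∑[ c < k ] agreesAt c r r'  ≡⟨ sum-cong-≗ (λ r → ∑-comm (λ r' c → agreesAt c r r')) ⟩
    ∑[ r < N ] ∑[ c < k ] ∑[ r' < N ] agreesAt c r r'  ≡⟨ ∑-comm (λ r c → ∑[ r' < N ] agreesAt c r r') ⟩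
    ∑[ c < k ] ∑[ r < N ] ∑[ r' < N ] agreesAt c r r'  ≡⟨ sum-cong-≗ ∑∑-agreesAt ⟩
    ∑[ c < k ] symCountSquares c                        ∎
    where open ≡-Reasoning

  ∑∑-agreements² : ∑[ r < N ] ∑[ r' < N ] (agreements A r r' * agreements A r r')
                   ≡ ∑[ c < k ] ∑[ c' < k ] pairCountSquares c c'
  ∑∑-agreements² = begin
    ∑[ r < N ] ∑[ r' < N ] (agreements A r r' * agreements A r r')
      ≡⟨ sum-cong-≗ (λ r → sum-cong-≗ (λ r' → agreements²≡∑∑ r r')) ⟩
    ∑[ r < N ] ∑[ r' < N ] ∑[ c < k ] ∑[ c' < k ] G r r' c c'
      ≡⟨ sum-cong-≗ (λ r → ∑-comm (λ r' c → ∑[ c' < k ] G r r' c c')) ⟩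
    ∑[ r < N ] ∑[ c < k ] ∑[ r' < N ] ∑[ c' < k ] G r r' c c'
      ≡⟨ sum-cong-≗ (λ r → sum-cong-≗ (λ c → ∑-comm (λ r' c' → G r r' c c'))) ⟩
    ∑[ r < N ] ∑[ c < k ] ∑[ c' < k ] ∑[ r' < N ] G r r' c c'
      ≡⟨ ∑-comm (λ r c → ∑[ c' < k ] ∑[ r' < N ] G r r' c c') ⟩
    ∑[ c < k ] ∑[ r < N ] ∑[ c' < k ] ∑[ r' < N ] G r r' c c'
      ≡⟨ sum-cong-≗ (λ c → ∑-comm (λ r c' → ∑[ r' < N ] G r r' c c')) ⟩
    ∑[ c < k ] ∑[ c' < k ] ∑[ r < N ] ∑[ r' < N ] G r r' c c'
      ≡⟨ sum-cong-≗ (λ c → sum-cong-≗ (∑∑-agreesAt-pair c)) ⟩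
    ∑[ c < k ] ∑[ c' < k ] pairCountSquares c c'
      ∎
    where
    open ≡-Reasoning
    G : Fin N → Fin N → Fin k → Fin k → ℕ
    G r r' c c' = agreesAt c r r' * agreesAt c' r r'
    agreements²≡∑∑ : ∀ r r' → agreements A r r' * agreements A r r' ≡ ∑[ c < k ] ∑[ c' < k ] G r r' c c'
    agreements²≡∑∑ r r' = begin
      agreements A r r' * agreements A r r'                   ≡⟨ cong₂ _*_ (agreements≡∑ r r') (agreements≡∑ r r') ⟩
      (∑[ c < k ] agreesAt c r r') * (∑[ c' < k ] agreesAt c' r r')
                                                              ≡⟨ *-distribʳ-sum _ (λ c → agreesAt c r r') ⟩
      ∑[ c < k ] (agreesAt c r r' * ∑[ c' < k ] agreesAt c' r r')
                                                              ≡⟨ sum-cong-≗ (λ c → *-distribˡ-sum (agreesAt c r r') (λ c' → agreesAt c' r r')) ⟩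
      ∑[ c < k ] ∑[ c' < k ] G r r' c c'                     ∎

n≤m≤1+n⇒m≡n⊎m≡1+n : ∀ {m n} → n ≤ m → m ≤ suc n → m ≡ n ⊎ m ≡ suc n
n≤m≤1+n⇒m≡n⊎m≡1+n n≤m m≤1+n with m≤n⇒m<n∨m≡n m≤1+n
... | inj₁ m<1+n = inj₁ (≤-antisym (≤-pred m<1+n) n≤m)
... | inj₂ m≡1+n = inj₂ m≡1+n

𝟙[m≟2]≡m∸1 : ∀ {m} → m ≡ 1 ⊎ m ≡ 2 → 𝟙 (m ℕ.≟ 2) ≡ m ∸ 1
𝟙[m≟2]≡m∸1 (inj₁ refl) = refl
𝟙[m≟2]≡m∸1 (inj₂ refl) = refl

module _ {N k v} {A : Array N k v} (cov : IsCA A) (≤1+v : ∀ c x → symCount A c x ≤ suc v) where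

  pairCount-pos : ∀ {c c'} → c ≢ c' → ∀ x y → 1 ≤ pairCount A c c' x y
  pairCount-pos {c} {c'} c≢c' x y with cov c c' c≢c' x y
  ... | r , Arc≡x , Arc'≡y = begin
    1                                            ≡⟨ cong₂ _*_ (𝟙-yes (A r c ≟ x) Arc≡x) (𝟙-yes (A r c' ≟ y) Arc'≡y) ⟨
    𝟙 (A r c ≟ x) * 𝟙 (A r c' ≟ y)               ≤⟨ term≤∑ (λ r → 𝟙 (A r c ≟ x) * 𝟙 (A r c' ≟ y)) r ⟩
    ∑[ r < N ] (𝟙 (A r c ≟ x) * 𝟙 (A r c' ≟ y))  ≡⟨ pairCount≡∑ A c c' x y ⟨
    pairCount A c c' x y                         ∎
    where open ≤-Reasoning

  ∑-pairCount∸1 : ∀ {c c'} → c ≢ c' → ∀ x → ∑[ y < v ] (pairCount A c c' x y ∸ 1) + v ≡ symCount A c x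
  ∑-pairCount∸1 {c} {c'} c≢c' x = begin
    ∑[ y < v ] (pairCount A c c' x y ∸ 1) + v       ≡⟨ cong (∑[ y < v ] (pairCount A c c' x y ∸ 1) +_) (*-identityʳ v) ⟨
    ∑[ y < v ] (pairCount A c c' x y ∸ 1) + v * 1   ≡⟨ ∑-+-const (λ y → pairCount A c c' x y ∸ 1) 1 ⟨
    ∑[ y < v ] (pairCount A c c' x y ∸ 1 + 1)       ≡⟨ sum-cong-≗ (λ y → m∸n+n≡m (pairCount-pos c≢c' x y)) ⟩
    ∑[ y < v ] pairCount A c c' x y                 ≡⟨ ∑-pairCount A c c' x ⟩
    symCount A c x                                  ∎
    where open ≡-Reasoning

  ∑-pairCount∸1≤1 : ∀ {c c'} → c ≢ c' → ∀ x → ∑[ y < v ] (pairCount A c c' x y ∸ 1) ≤ 1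
  ∑-pairCount∸1≤1 {c} c≢c' x =
    +-cancelʳ-≤ v _ 1 (subst (_≤ suc v) (sym (∑-pairCount∸1 c≢c' x)) (≤1+v c x))

  pairCount∈ : ∀ {c c'} → c ≢ c' → ∀ x y → pairCount A c c' x y ≡ 1 ⊎ pairCount A c c' x y ≡ 2
  pairCount∈ {c} {c'} c≢c' x y = n≤m≤1+n⇒m≡n⊎m≡1+n (pairCount-pos c≢c' x y) (begin
    pairCount A c c' x y                          ≤⟨ m≤n+m∸n (pairCount A c c' x y) 1 ⟩
    1 + (pairCount A c c' x y ∸ 1)                ≤⟨ +-monoʳ-≤ 1 (term≤∑ (λ y → pairCount A c c' x y ∸ 1) y) ⟩
    1 + ∑[ y < v ] (pairCount A c c' x y ∸ 1)     ≤⟨ +-monoʳ-≤ 1 (∑-pairCount∸1≤1 c≢c' x) ⟩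
    2                                             ∎)
    where open ≤-Reasoning

  pairCount≡2-unique : ∀ {c c'} → c ≢ c' → ∀ {x y y'} →
                       pairCount A c c' x y ≡ 2 → pairCount A c c' x y' ≡ 2 → y ≡ y'
  pairCount≡2-unique {c} {c'} c≢c' {x} {y} {y'} p≡2 p'≡2 with y ≟ y'
  ... | yes y≡y' = y≡y'
  ... | no y≢y' = contradiction
    (subst₂ (λ a b → (a ∸ 1) + (b ∸ 1) ≤ 1) p≡2 p'≡2
      (≤-trans (two-terms≤∑ (λ y → pairCount A c c' x y ∸ 1) y≢y') (∑-pairCount∸1≤1 c≢c' x)))
    λ { (s≤s ()) }

  symCount∈ : ∀ {c c'} → c ≢ c' → ∀ x → symCount A c x ≡ v ⊎ symCount A c x ≡ suc v
  symCount∈ {c} c≢c' x = n≤m≤1+n⇒m≡n⊎m≡1+n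
    (subst (v ≤_) (∑-pairCount∸1 c≢c' x) (m≤n+m v _)) (≤1+v c x)

  twicePairsCount+v*v : ∀ {c c'} → c ≢ c' → twicePairsCount A c c' + v * v ≡ N
  twicePairsCount+v*v {c} {c'} c≢c' = begin
    twicePairsCount A c c' + v * v                            ≡⟨ cong (_+ v * v) (sumFin≡sum twice) ⟩
    ∑[ x < v ] twice x + v * v                                ≡⟨ cong (_+ v * v) (sum-cong-≗ twice≡∑∸1) ⟩
    ∑[ x < v ] ∑[ y < v ] (pairCount A c c' x y ∸ 1) + v * v  ≡⟨ ∑-+-const (λ x → ∑[ y < v ] (pairCount A c c' x y ∸ 1)) v ⟨
    ∑[ x < v ] (∑[ y < v ] (pairCount A c c' x y ∸ 1) + v)    ≡⟨ sum-cong-≗ (∑-pairCount∸1 c≢c') ⟩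
    ∑[ x < v ] symCount A c x                                 ≡⟨ ∑-symCount A c ⟩
    N                                                         ∎
    where
    open ≡-Reasoning
    twice : Fin v → ℕ
    twice x = count (λ y → pairCount A c c' x y ℕ.≟ 2)
    twice≡∑∸1 : ∀ x → twice x ≡ ∑[ y < v ] (pairCount A c c' x y ∸ 1)
    twice≡∑∸1 x = trans (count≡∑𝟙 (λ y → pairCount A c c' x y ℕ.≟ 2))
                        (sum-cong-≗ (λ y → 𝟙[m≟2]≡m∸1 (pairCount∈ c≢c' x y)))

  twicePairsCount≡v∸1 : v * suc v ≡ suc N → ∀ {c c'} → c ≢ c' → twicePairsCount A c c' ≡ v ∸ 1
  twicePairsCount≡v∸1 v*suc[v]≡suc[N] {c} {c'} c≢c' = cong (_∸ 1) (+-cancelʳ-≡ (v * v) _ _ (begin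
    suc (twicePairsCount A c c') + v * v   ≡⟨ cong suc (twicePairsCount+v*v c≢c') ⟩
    suc N                                  ≡⟨ v*suc[v]≡suc[N] ⟨
    v * suc v                              ≡⟨ *-suc v v ⟩
    v + v * v                              ∎))
    where open ≡-Reasoning

  twicePairs-disjoint : ∀ {c c'} → c ≢ c' → TwicePairsDisjoint A c c'
  twicePairs-disjoint {c} {c'} c≢c' x y x' y' p≡2 p'≡2 distinct with x ≟ x' | y ≟ y'
  ... | yes x≡x' | yes y≡y' = contradiction (x≡x' , y≡y') distinct
  ... | yes refl | no y≢y'  = contradiction (pairCount≡2-unique c≢c' p≡2 p'≡2) y≢y'
  ... | no x≢x'  | yes refl = contradiction
    (pairCount≡2-unique (c≢c' ∘ sym) (trans (sym (pairCount-swap A c c' x y)) p≡2)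
                                      (trans (sym (pairCount-swap A c c' x' y)) p'≡2)) x≢x'
  ... | no x≢x'  | no y≢y'  = x≢x' , y≢y'

∑-squares-of-consecutive : ∀ {n} {f : Fin n → ℕ} {a} → (∀ i → f i ≡ a ⊎ f i ≡ suc a) →
                           ∑[ i < n ] (f i * f i) + n * (a * suc a) ≡ (a + suc a) * sum f
∑-squares-of-consecutive {n} {f} {a} f∈ = begin
  ∑[ i < n ] (f i * f i) + n * (a * suc a)    ≡⟨ ∑-+-const (λ i → f i * f i) (a * suc a) ⟨
  ∑[ i < n ] (f i * f i + a * suc a)          ≡⟨ sum-cong-≗ (λ i → square (f∈ i)) ⟩
  ∑[ i < n ] ((a + suc a) * f i)              ≡⟨ *-distribˡ-sum (a + suc a) f ⟨
  (a + suc a) * sum f                         ∎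
  where
  open ≡-Reasoning
  square : ∀ {m} → m ≡ a ⊎ m ≡ suc a → m * m + a * suc a ≡ (a + suc a) * m
  square (inj₁ refl) = lemma a
    where
    lemma : ∀ a → a * a + a * suc a ≡ (a + suc a) * a
    lemma = solve-∀
  square (inj₂ refl) = lemma a
    where
    lemma : ∀ a → suc a * suc a + a * suc a ≡ (a + suc a) * suc a
    lemma = solve-∀

∑∑-diagonal≤ : ∀ {n} (g : Fin n → Fin n → ℕ) → ∑[ r < n ] g r r ≤ ∑[ r < n ] ∑[ r' < n ] g r r'
∑∑-diagonal≤ g = ∑-mono-≤ (λ r → term≤∑ (g r) r)

∑∑-diagonal+≤ : ∀ {n} (g : Fin n → Fin n → ℕ) {r₀ r₁} → r₀ ≢ r₁ →
                ∑[ r < n ] g r r + g r₀ r₁ ≤ ∑[ r < n ] ∑[ r' < n ] g r r'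
∑∑-diagonal+≤ g {r₀} r₀≢r₁ = ∑-mono-≤-gap r₀ (λ r → term≤∑ (g r) r) (two-terms≤∑ (g r₀) r₀≢r₁)

-- (m − 1)(m − 2), which is a natural number for every m.
excess : ℕ → ℕ
excess zero = 2
excess (suc m) = m * (m ∸ 1)

excess+3*m≡m*m+2 : ∀ m → excess m + 3 * m ≡ m * m + 2
excess+3*m≡m*m+2 zero = refl
excess+3*m≡m*m+2 (suc zero) = refl
excess+3*m≡m*m+2 (suc (suc m)) = lemma m
  where
  lemma : ∀ m → suc m * m + 3 * suc (suc m) ≡ suc (suc m) * suc (suc m) + 2
  lemma = solve-∀

excess≡0⇒m≡1⊎m≡2 : ∀ m → excess m ≡ 0 → m ≡ 1 ⊎ m ≡ 2
excess≡0⇒m≡1⊎m≡2 zero ()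
excess≡0⇒m≡1⊎m≡2 (suc zero) _ = inj₁ refl
excess≡0⇒m≡1⊎m≡2 (suc (suc zero)) _ = inj₂ refl
excess≡0⇒m≡1⊎m≡2 (suc (suc (suc m))) ()

-- S₁, S₂ and E stand for the sums of λ, λ² and (λ − 1)(λ − 2) over all ordered pairs of rows,
-- where λ is the number of agreements.
moment-elimination : ∀ v N E S₁ S₂ →
  S₁ + (v + 2) * (v * (v * suc v)) ≡ (v + 2) * ((v + suc v) * N) →
  S₂ + (v + 2) * (suc v * (v * (v * 2))) ≡ S₁ + (v + 2) * (suc v * (3 * N)) →
  E + 3 * S₁ ≡ S₂ + N * (N * 2) →
  E + N * (v * suc v) ≡ 2 * (N * suc N)
moment-elimination v N E S₁ S₂ h₁ h₂ h₃ = +-cancelʳ-≡ R _ _ (begin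
  E + N * (v * suc v) + R
    ≡⟨ regroup v N E S₁ S₂ ⟩
  2 * (N * suc N) + (E + 3 * S₁ + (S₂ + X₂) + 2 * Y₁)
    ≡⟨ cong₂ (λ a b → 2 * (N * suc N) + (a + b + 2 * Y₁)) h₃ h₂ ⟩
  2 * (N * suc N) + (S₂ + N * (N * 2) + (S₁ + Y₂) + 2 * Y₁)
    ≡⟨ cong (λ a → 2 * (N * suc N) + (S₂ + N * (N * 2) + (S₁ + Y₂) + 2 * a)) h₁ ⟨
  2 * (N * suc N) + R
    ∎)
  where
  open ≡-Reasoning
  X₁ Y₁ X₂ Y₂ R : ℕ
  X₁ = (v + 2) * (v * (v * suc v))
  Y₁ = (v + 2) * ((v + suc v) * N)
  X₂ = (v + 2) * (suc v * (v * (v * 2)))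
  Y₂ = (v + 2) * (suc v * (3 * N))
  R = S₂ + N * (N * 2) + (S₁ + Y₂) + 2 * (S₁ + X₁)
  regroup : ∀ v N E S₁ S₂ →
    E + N * (v * suc v) + (S₂ + N * (N * 2) + (S₁ + (v + 2) * (suc v * (3 * N))) + 2 * (S₁ + (v + 2) * (v * (v * suc v))))
    ≡ 2 * (N * suc N) + (E + 3 * S₁ + (S₂ + (v + 2) * (suc v * (v * (v * 2)))) + 2 * ((v + 2) * ((v + suc v) * N)))
  regroup = solve-∀

double : ∀ m → 2 * m ≡ m + m
double m = cong (m +_) (+-identityʳ m)

∃≢ : ∀ {k} → 2 ≤ k → (c : Fin k) → ∃ (c ≢_)
∃≢ (s≤s (s≤s _)) zero = suc zero , λ ()
∃≢ (s≤s (s≤s _)) (suc c) = zero , λ ()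

module _ {N v} {A : Array N (v + 2) v} (cov : IsCA A) (≤1+v : ∀ c x → symCount A c x ≤ suc v) where

  symCountSquares+ : ∀ c → symCountSquares A c + v * (v * suc v) ≡ (v + suc v) * N
  symCountSquares+ c =
    trans (∑-squares-of-consecutive (symCount∈ cov ≤1+v (proj₂ (∃≢ (m≤n+m 2 v) c))))
          (cong ((v + suc v) *_) (∑-symCount A c))

  pairCountSquares+ : ∀ {c c'} → c ≢ c' → pairCountSquares A c c' + v * (v * 2) ≡ 3 * N
  pairCountSquares+ {c} {c'} c≢c' = begin
    pairCountSquares A c c' + v * (v * 2)        ≡⟨ ∑-+-const (λ x → ∑[ y < v ] (p x y * p x y)) (v * 2) ⟨
    ∑[ x < v ] (∑[ y < v ] (p x y * p x y) + v * 2)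
                                                  ≡⟨ sum-cong-≗ (λ x → ∑-squares-of-consecutive (pairCount∈ cov ≤1+v c≢c' x)) ⟩
    ∑[ x < v ] (3 * ∑[ y < v ] p x y)            ≡⟨ sum-cong-≗ (λ x → cong (3 *_) (∑-pairCount A c c' x)) ⟩
    ∑[ x < v ] (3 * symCount A c x)              ≡⟨ *-distribˡ-sum 3 (symCount A c) ⟨
    3 * ∑[ x < v ] symCount A c x                ≡⟨ cong (3 *_) (∑-symCount A c) ⟩
    3 * N                                        ∎
    where
    open ≡-Reasoning
    p : Fin v → Fin v → ℕ
    p = pairCount A c c'

  ∑-pairCountSquares+ : ∀ c → ∑[ c' < v + 2 ] pairCountSquares A c c' + suc v * (v * (v * 2))
                              ≡ symCountSquares A c + suc v * (3 * N)
  ∑-pairCountSquares+ c = begin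
    ∑[ c' < v + 2 ] pairCountSquares A c c' + suc v * (v * (v * 2))
      ≡⟨ subst (λ m → ∑[ c' < v + 2 ] pairCountSquares A c c' + m * (v * (v * 2)) ≡ pairCountSquares A c c + m * (3 * N))
               (cong pred (+-comm v 2))
               (∑-except (pairCountSquares A c) c (λ c' c'≢c → pairCountSquares+ (c'≢c ∘ sym))) ⟩
    pairCountSquares A c c + suc v * (3 * N)
      ≡⟨ cong (_+ suc v * (3 * N)) (pairCountSquares-diag A c) ⟩
    symCountSquares A c + suc v * (3 * N)
      ∎
    where open ≡-Reasoning

  ∑∑-excess-agreements : ∑[ r < N ] ∑[ r' < N ] excess (agreements A r r') + N * (v * suc v) ≡ 2 * (N * suc N)
  ∑∑-excess-agreements = moment-elimination v N E S₁ S₂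
    (∑-+-cong-const symCountSquares+)
    (∑-+-cong ∑-pairCountSquares+)
    (begin
      E + 3 * S₁                                          ≡⟨ cong (λ t → E + 3 * t) (∑∑-agreements A) ⟨
      E + 3 * ∑[ r < N ] ∑[ r' < N ] agreements A r r'
        ≡⟨ ∑-+-*-cong {a = 3} {b = N * 2} (λ r → ∑-+-*-cong {a = 3} {b = 2} (λ r' → excess+3*m≡m*m+2 (agreements A r r'))) ⟩
      ∑[ r < N ] ∑[ r' < N ] (agreements A r r' * agreements A r r') + N * (N * 2)
        ≡⟨ cong (_+ N * (N * 2)) (∑∑-agreements² A) ⟩
      S₂ + N * (N * 2)
        ∎)
    where
    open ≡-Reasoning
    E S₁ S₂ : ℕ
    E = ∑[ r < N ] ∑[ r' < N ] excess (agreements A r r')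
    S₁ = ∑[ c < v + 2 ] symCountSquares A c
    S₂ = ∑[ c < v + 2 ] ∑[ c' < v + 2 ] pairCountSquares A c c'

  ∑-excess-diagonal : ∑[ r < N ] excess (agreements A r r) ≡ N * (v * suc v)
  ∑-excess-diagonal = trans (sum-cong-≗ excess-diagonal) (∑-const N (v * suc v))
    where
    excess-diagonal : ∀ r → excess (agreements A r r) ≡ v * suc v
    excess-diagonal r = trans (cong excess (trans (agreements-diag A r) (+-comm v 2))) (*-comm (suc v) v)

  v*suc[v]≤suc[N] : Fin N → v * suc v ≤ suc N
  v*suc[v]≤suc[N] r₀ = *-cancelˡ-≤ N {{nonZeroIndex r₀}} (*-cancelˡ-≤ 2 (begin
    2 * (N * (v * suc v))                                    ≡⟨ double (N * (v * suc v)) ⟩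
    N * (v * suc v) + N * (v * suc v)                        ≤⟨ +-monoˡ-≤ _ diagonal≤ ⟩
    ∑[ r < N ] ∑[ r' < N ] excess (agreements A r r') + N * (v * suc v)  ≡⟨ ∑∑-excess-agreements ⟩
    2 * (N * suc N)                                          ∎))
    where
    open ≤-Reasoning
    diagonal≤ : N * (v * suc v) ≤ ∑[ r < N ] ∑[ r' < N ] excess (agreements A r r')
    diagonal≤ = subst (_≤ ∑[ r < N ] ∑[ r' < N ] excess (agreements A r r')) ∑-excess-diagonal
                      (∑∑-diagonal≤ (λ r r' → excess (agreements A r r')))

  agreements∈ : v * suc v ≡ suc N → ∀ {r r'} → r ≢ r' → agreements A r r' ≡ 1 ⊎ agreements A r r' ≡ 2
  agreements∈ v*suc[v]≡suc[N] {r} {r'} r≢r' = excess≡0⇒m≡1⊎m≡2 _ (n≤0⇒n≡0 (+-cancelˡ-≤ (N * (v * suc v)) _ 0 (begin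
    N * (v * suc v) + excess (agreements A r r')              ≡⟨ cong (_+ _) ∑-excess-diagonal ⟨
    ∑[ r < N ] excess (agreements A r r) + excess (agreements A r r')
                                                              ≤⟨ ∑∑-diagonal+≤ (λ r r' → excess (agreements A r r')) r≢r' ⟩
    ∑[ r < N ] ∑[ r' < N ] excess (agreements A r r')         ≡⟨ ∑∑-excess≡diagonal ⟩
    N * (v * suc v)                                           ≡⟨ +-identityʳ _ ⟨
    N * (v * suc v) + 0                                       ∎)))
    where
    open ≤-Reasoning
    ∑∑-excess≡diagonal : ∑[ r < N ] ∑[ r' < N ] excess (agreements A r r') ≡ N * (v * suc v)
    ∑∑-excess≡diagonal = +-cancelʳ-≡ (N * (v * suc v)) _ _ (begin-equality
      ∑[ r < N ] ∑[ r' < N ] excess (agreements A r r') + N * (v * suc v)  ≡⟨ ∑∑-excess-agreements ⟩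
      2 * (N * suc N)                      ≡⟨ cong (λ m → 2 * (N * m)) v*suc[v]≡suc[N] ⟨
      2 * (N * (v * suc v))                ≡⟨ double (N * (v * suc v)) ⟩
      N * (v * suc v) + N * (v * suc v)    ∎)

⌈N/v⌉≤1+v : ∀ {N v} .{{_ : NonZero v}} → N ≤ v * suc v → (N + (v ∸ 1)) / v ≤ suc v
⌈N/v⌉≤1+v {N} {suc w} N≤v*suc[v] = ≤-pred (m<n*o⇒m/o<n (begin
  suc (N + w)                    ≡⟨ +-suc N w ⟨
  N + suc w                      ≤⟨ +-monoˡ-≤ (suc w) N≤v*suc[v] ⟩
  suc w * suc (suc w) + suc w    ≡⟨ lemma w ⟩
  suc (suc (suc w)) * suc w      ∎))
  where
  open ≤-Reasoning
  lemma : ∀ w → suc w * suc (suc w) + suc w ≡ suc (suc (suc w)) * suc w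
  lemma = solve-∀

uniform⇒symCount≤1+v : ∀ {N k v} .{{_ : NonZero v}} {A : Array N k v} → IsUniform A → N ≤ v * suc v →
                       ∀ c x → symCount A c x ≤ suc v
uniform⇒symCount≤1+v {N} {v = v} uniform N≤v*suc[v] c x with uniform c x
... | inj₁ ≡⌊N/v⌋ = ≤-trans (≤-reflexive ≡⌊N/v⌋) (≤-trans (/-monoˡ-≤ v (m≤m+n N (v ∸ 1))) (⌈N/v⌉≤1+v N≤v*suc[v]))
... | inj₂ ≡⌈N/v⌉ = ≤-trans (≤-reflexive ≡⌈N/v⌉) (⌈N/v⌉≤1+v N≤v*suc[v])

v*suc[v]≡suc[v*v+v∸1] : ∀ v .{{_ : NonZero v}} → v * suc v ≡ suc (v * v + v ∸ 1)
v*suc[v]≡suc[v*v+v∸1] (suc w) = lemma w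
  where
  lemma : ∀ w → suc w * suc (suc w) ≡ suc (w + w * suc w + suc w)
  lemma = solve-∀

UCA⇒v*v+v∸1≤N : ∀ {N v} .{{_ : NonZero v}} {A : Array N (v + 2) v} → IsUCA A → v * v + v ∸ 1 ≤ N
UCA⇒v*v+v∸1≤N {N} {v@(suc _)} (cov , uniform) with N ≤? v * suc v
... | no N≰v*suc[v] = ≤-trans (n≤1+n _) (<⇒≤ (subst (_< N) (v*suc[v]≡suc[v*v+v∸1] v) (≰⇒> N≰v*suc[v])))
... | yes N≤v*suc[v] = ≤-pred (subst (_≤ suc N) (v*suc[v]≡suc[v*v+v∸1] v)
        (v*suc[v]≤suc[N] cov (uniform⇒symCount≤1+v uniform N≤v*suc[v]) r₀))
  where
  r₀ : Fin N
  r₀ = proj₁ (cov zero (proj₁ (∃≢ (m≤n+m 2 v) zero)) (proj₂ (∃≢ (m≤n+m 2 v) zero)) zero zero)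

UCA-extremal : ∀ {N v} .{{_ : NonZero v}} {A : Array N (v + 2) v} → IsUCA A → N ≡ v * v + v ∸ 1 →
  ((r r' : Fin N) → r ≢ r' → (agreements A r r' ≡ 1) ⊎ (agreements A r r' ≡ 2)) ×
  ((c c' : Fin (v + 2)) → c ≢ c' → (twicePairsCount A c c' ≡ v ∸ 1) × TwicePairsDisjoint A c c')
UCA-extremal {N} {v} {A} (cov , uniform) N≡v*v+v∸1 =
  (λ r r' → agreements∈ cov ≤1+v v*suc[v]≡suc[N]) ,
  (λ c c' c≢c' → twicePairsCount≡v∸1 cov ≤1+v v*suc[v]≡suc[N] c≢c' , twicePairs-disjoint cov ≤1+v c≢c')
  where
  v*suc[v]≡suc[N] : v * suc v ≡ suc N
  v*suc[v]≡suc[N] = trans (v*suc[v]≡suc[v*v+v∸1] v) (cong suc (sym N≡v*v+v∸1))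
  ≤1+v : ∀ c x → symCount A c x ≤ suc v
  ≤1+v = uniform⇒symCount≤1+v uniform (subst (N ≤_) (sym v*suc[v]≡suc[N]) (n≤1+n N))

corollary1 : (v : ℕ) → 2 ≤ v → .{{_ : NonZero v}} → (N : ℕ) → (A : Array N (v + 2) v) → IsUCA A →
    (v * v + v ∸ 1 ≤ N) ×
    (N ≡ v * v + v ∸ 1 →
      ((r r' : Fin N) → r ≢ r' → (agreements A r r' ≡ 1) ⊎ (agreements A r r' ≡ 2)) ×
      ((c c' : Fin (v + 2)) → c ≢ c' → (twicePairsCount A c c' ≡ v ∸ 1) × TwicePairsDisjoint A c c'))
corollary1 v _ N A uca = UCA⇒v*v+v∸1≤N uca , UCA-extremal uca
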